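{- Suppose that for every pair of complete lattices $(Y,X)$ we are given a map $\psi_{Y,X} : Y \times X \to \mathrm{Hom}_{\vee}(X,Y)$ that is a bimorphism $Y\times X^{op}\to \mathrm{Hom}_{\vee}(X,Y)$, i.e. $\psi_{Y,X}(\bigvee_i y_i, x) = \bigvee_i \psi_{Y,X}(y_i,x)$ and $\psi_{Y,X}(y,\bigwedge_i x_i) = \bigvee_i \psi_{Y,X}(y,x_i)$ for all families, and suppose the family is natural: for all complete lattices $X,X',Y,Y'$, all $g \in \mathrm{Hom}_{\vee}(X',X)$, $f \in \mathrm{Hom}_{\vee}(Y,Y')$, $y\in Y$, $x\in X$, $$\psi_{Y',X'}\big(f(y), \rho(g)(x)\big) = f \circ \psi_{Y,X}(y,x) \circ g .$$ Then either every $\psi_{Y,X}$ is constantly equal to the bottom map $\bot$, or $\psi_{Y,X}(y,x) = e_{y,x}$ for all $X,Y,x,y$ (equivalently, the induced sup-preserving map $\mathrm{Hom}_{\wedge}(X,Y)\to\mathrm{Hom}_{\vee}(X,Y)$, $g \mapsto \bigvee_{x\in X}\psi_{Y,X}(g(x),x)$, is Raney's transform $g \mapsto g^{\vee}$). That is, there are exactly two natural arrows from $Y\otimes X^{op}$ to $\mathrm{Hom}_{\vee}(X,Y)$: the trivial one and Raney's transform.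
   Context: For complete lattices $X,Y$: $\mathrm{Hom}_{\vee}(X,Y)$ is the complete lattice of join-preserving maps $X \to Y$ ordered pointwise, and $\mathrm{Hom}_{\wedge}(X,Y)$ is the poset of meet-preserving maps $X\to Y$ ordered pointwise. For $g \in \mathrm{Hom}_{\vee}(X',X)$, $\rho(g): X \to X'$ is its right adjoint. For $y\in Y$, $x\in X$, $e_{y,x}\in\mathrm{Hom}_{\vee}(X,Y)$ is given by $e_{y,x}(t) = y$ if $t\not\leq x$ and $e_{y,x}(t)=\bot$ if $t \leq x$. Raney's transform of $g \in \mathrm{Hom}_{\wedge}(X,Y)$ is $g^{\vee}(x) = \bigvee_{t\in X,\ x \not\leq t} g(t)$; it lies in $\mathrm{Hom}_{\vee}(X,Y)$. The tensor product $Y\otimes X^{op}$ in the category of complete lattices and join-preserving maps is realized as $\mathrm{Hom}_{\wedge}(X,Y)$, and bimorphisms $Y\times X^{op}\to Z$ correspond to join-preserving maps out of it via $g\mapsto \bigvee_{x}\psi(g(x),x)$. -}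

module Defs where

open import Level using (Level; suc; Lift)
open import Data.Empty using (⊥)
open import Data.Product using (Σ; proj₁)
open import Function using (_∘_)
open import Relation.Binary.PropositionalEquality using (_≡_)
open import Relation.Binary.Structures using (IsPartialOrder)

record CompleteLattice (ℓ : Level) : Set (suc ℓ) where
  infix 4 _≤_
  field
    Carrier        : Set ℓ
    _≤_            : Carrier → Carrier → Set ℓ
    isPartialOrder : IsPartialOrder _≡_ _≤_
    ⋁              : {I : Set ℓ} → (I → Carrier) → Carrier
    ⋁-upper        : {I : Set ℓ} (f : I → Carrier) (j : I) → f j ≤ ⋁ f
    ⋁-least        : {I : Set ℓ} (f : I → Carrier) (u : Carrier) →
                     ((j : I) → f j ≤ u) → ⋁ f ≤ u
    ⋀              : {I : Set ℓ} → (I → Carrier) → Carrier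
    ⋀-lower        : {I : Set ℓ} (f : I → Carrier) (j : I) → ⋀ f ≤ f j
    ⋀-greatest     : {I : Set ℓ} (f : I → Carrier) (u : Carrier) →
                     ((j : I) → u ≤ f j) → u ≤ ⋀ f

  ⊥L : Carrier
  ⊥L = ⋁ {Lift ℓ ⊥} (λ ())

open CompleteLattice public

record JoinHom {ℓ : Level} (X Y : CompleteLattice ℓ) : Set (suc ℓ) where
  field
    fun      : Carrier X → Carrier Y
    pres-⋁   : {I : Set ℓ} (h : I → Carrier X) → fun (⋁ X h) ≡ ⋁ Y (fun ∘ h)

open JoinHom public

-- Right adjoint ρ(g) : X → X' of a join-preserving g : X' → X,
-- ρ(g)(x) = ⋁ { t ∈ X' | g t ≤ x }.
ρ : {ℓ : Level} {X' X : CompleteLattice ℓ} → JoinHom X' X → Carrier X → Carrier X'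
ρ {X' = X'} {X = X} g x = ⋁ X' {Σ (Carrier X') (λ t → _≤_ X (fun g t) x)} proj₁

IsE : {ℓ : Level} (X Y : CompleteLattice ℓ) → Carrier Y → Carrier X → JoinHom X Y → Set ℓ
IsE X Y y x φ = (t : Carrier X) →
  ((_≤_ X t x → fun φ t ≡ ⊥L Y) Data.Product.× ((_≤_ X t x → ⊥) → fun φ t ≡ y))

-- Join-preserving maps 𝟚 → Y correspond to elements y of Y, and join-preserving
-- maps X → 𝟚 to elements x of X (through their right adjoints evaluated at ⊥).
-- Applying naturality to this pair of maps, with the component ψ_{𝟚,𝟚}(⊤,⊥) in
-- the middle, shows that every ψ_{Y,X}(y,x) is the composite 𝟚-valued test
-- "t ≰ x", followed by the endomap φ = ψ_{𝟚,𝟚}(⊤,⊥), followed by the point y.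
-- A join-preserving endomap of 𝟚 fixes ⊥, so φ is either constantly ⊥ (and then
-- so is every ψ) or the identity (and then ψ_{Y,X}(y,x) = e_{y,x}).
module Submission where

open import Defs
open import Level using (Level; Lift)
open import Data.Empty using (⊥; ⊥-elim)
open import Data.Product using (Σ; _,_; proj₁)
open import Data.Sum using (_⊎_; inj₁; inj₂; [_,_]′)
open import Function using (_∘_; _⇔_; mk⇔; Equivalence)
open import Relation.Binary.PropositionalEquality
  using (_≡_; refl; sym; trans; cong; subst; isEquivalence)
open import Relation.Binary.Structures using (IsPartialOrder)
open import Relation.Nullary using (Dec; yes; no; ¬_)
open import Relation.Nullary.Decidable using (¬?)
open import Axiom.ExcludedMiddle using (ExcludedMiddle)

open Equivalence using (to; from)

module Order {ℓ : Level} (L : CompleteLattice ℓ) where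
  open IsPartialOrder (isPartialOrder L) public
    using (antisym; reflexive) renaming (refl to ≤-refl; trans to ≤-trans)

  ⊤L : Carrier L
  ⊤L = ⋀ L {Lift ℓ ⊥} (λ ())

  ⊥L-least : (u : Carrier L) → _≤_ L (⊥L L) u
  ⊥L-least u = ⋁-least L (λ ()) u (λ ())

  ⊤L-greatest : (u : Carrier L) → _≤_ L u ⊤L
  ⊤L-greatest u = ⋀-greatest L (λ ()) u (λ ())

  ⋁-≡-⊥L : {I : Set ℓ} (h : I → Carrier L) → (∀ j → h j ≡ ⊥L L) → ⋁ L h ≡ ⊥L L
  ⋁-≡-⊥L h h≡⊥ = antisym (⋁-least L h (⊥L L) (reflexive ∘ h≡⊥)) (⊥L-least (⋁ L h))

JoinHom-⊥ : {ℓ : Level} {X Y : CompleteLattice ℓ} (φ : JoinHom X Y) →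
            fun φ (⊥L X) ≡ ⊥L Y
JoinHom-⊥ {Y = Y} φ = trans (pres-⋁ φ (λ ())) (Order.⋁-≡-⊥L Y _ (λ ()))

GaloisConnection : {ℓ : Level} (X Y : CompleteLattice ℓ) →
                   (Carrier X → Carrier Y) → (Carrier Y → Carrier X) → Set ℓ
GaloisConnection X Y l r = ∀ t u → _≤_ Y (l t) u ⇔ _≤_ X t (r u)

module _ {ℓ : Level} {X Y : CompleteLattice ℓ}
         {l : Carrier X → Carrier Y} {r : Carrier Y → Carrier X}
         (gc : GaloisConnection X Y l r) where
  private
    module X = Order X
    module Y = Order Y

  leftAdjoint-monotone : ∀ {t t'} → _≤_ X t t' → _≤_ Y (l t) (l t')
  leftAdjoint-monotone {t} {t'} t≤t' =
    from (gc t (l t')) (X.≤-trans t≤t' (to (gc t' (l t')) Y.≤-refl))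

  leftAdjoint-pres-⋁ : {I : Set ℓ} (h : I → Carrier X) → l (⋁ X h) ≡ ⋁ Y (l ∘ h)
  leftAdjoint-pres-⋁ h = Y.antisym
    (from (gc _ _) (⋁-least X h _ (λ j → to (gc _ _) (⋁-upper Y (l ∘ h) j))))
    (⋁-least Y (l ∘ h) _ (λ j → leftAdjoint-monotone (⋁-upper X h j)))

  leftAdjointHom : JoinHom X Y
  leftAdjointHom = record { fun = l ; pres-⋁ = leftAdjoint-pres-⋁ }

  ρ-leftAdjointHom : (u : Carrier Y) → ρ leftAdjointHom u ≡ r u
  ρ-leftAdjointHom u = X.antisym
    (⋁-least X proj₁ (r u) (λ { (t , lt≤u) → to (gc t u) lt≤u }))
    (⋁-upper X proj₁ (r u , from (gc (r u) u) X.≤-refl))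

data 𝟚 {ℓ : Level} : Set ℓ where
  ⊥₂ ⊤₂ : 𝟚

module _ {ℓ : Level} where
  infix 4 _≤₂_
  data _≤₂_ : 𝟚 {ℓ} → 𝟚 {ℓ} → Set ℓ where
    ⊥₂≤ : ∀ {b} → ⊥₂ ≤₂ b
    ⊤₂≤⊤₂ : ⊤₂ ≤₂ ⊤₂

  ≤⊤₂ : (b : 𝟚) → b ≤₂ ⊤₂
  ≤⊤₂ ⊥₂ = ⊥₂≤
  ≤⊤₂ ⊤₂ = ⊤₂≤⊤₂

  ≤₂-refl : ∀ {b} → b ≤₂ b
  ≤₂-refl {⊥₂} = ⊥₂≤
  ≤₂-refl {⊤₂} = ⊤₂≤⊤₂

  ≤₂-trans : ∀ {a b c} → a ≤₂ b → b ≤₂ c → a ≤₂ c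
  ≤₂-trans ⊥₂≤ _ = ⊥₂≤
  ≤₂-trans ⊤₂≤⊤₂ b≤c = b≤c

  ≤₂-antisym : ∀ {a b} → a ≤₂ b → b ≤₂ a → a ≡ b
  ≤₂-antisym ⊥₂≤ ⊥₂≤ = refl
  ≤₂-antisym ⊤₂≤⊤₂ _ = refl

  ≤₂-isPartialOrder : IsPartialOrder _≡_ _≤₂_
  ≤₂-isPartialOrder = record
    { isPreorder = record
        { isEquivalence = isEquivalence
        ; reflexive = λ { refl → ≤₂-refl }
        ; trans = ≤₂-trans
        }
    ; antisym = ≤₂-antisym
    }

  fromDec : {P : Set ℓ} → Dec P → 𝟚 {ℓ}
  fromDec (yes _) = ⊤₂
  fromDec (no _) = ⊥₂

module TwoPoint {ℓ : Level} (lem : ExcludedMiddle ℓ) where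
  ⋁₂ : {I : Set ℓ} → (I → 𝟚 {ℓ}) → 𝟚
  ⋁₂ {I} h = fromDec (lem {Σ I (λ j → h j ≡ ⊤₂)})

  ⋁₂-upper : {I : Set ℓ} (h : I → 𝟚) (j : I) → h j ≤₂ ⋁₂ h
  ⋁₂-upper {I} h j with lem {Σ I (λ j → h j ≡ ⊤₂)} | h j in hj
  ... | yes _ | b = ≤⊤₂ b
  ... | no _ | ⊥₂ = ⊥₂≤
  ... | no ¬∃ | ⊤₂ = ⊥-elim (¬∃ (j , hj))

  ⋁₂-least : {I : Set ℓ} (h : I → 𝟚) (u : 𝟚) → ((j : I) → h j ≤₂ u) → ⋁₂ h ≤₂ u
  ⋁₂-least {I} h u h≤u with lem {Σ I (λ j → h j ≡ ⊤₂)}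
  ... | yes (j , hj) = subst (_≤₂ u) hj (h≤u j)
  ... | no _ = ⊥₂≤

  ⋀₂ : {I : Set ℓ} → (I → 𝟚 {ℓ}) → 𝟚
  ⋀₂ h = ⋁₂ {Σ 𝟚 (λ u → ∀ j → u ≤₂ h j)} proj₁

  𝟚L : CompleteLattice ℓ
  𝟚L = record
    { Carrier = 𝟚
    ; _≤_ = _≤₂_
    ; isPartialOrder = ≤₂-isPartialOrder
    ; ⋁ = ⋁₂
    ; ⋁-upper = ⋁₂-upper
    ; ⋁-least = ⋁₂-least
    ; ⋀ = ⋀₂
    ; ⋀-lower = λ h j → ⋁₂-least proj₁ (h j) (λ { (_ , u≤h) → u≤h j })
    ; ⋀-greatest = λ h u u≤h → ⋁₂-upper proj₁ (u , u≤h)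
    }

  ⊥L-𝟚L : ⊥L 𝟚L ≡ ⊥₂
  ⊥L-𝟚L = ≤₂-antisym (Order.⊥L-least 𝟚L ⊥₂) ⊥₂≤

  JoinHom-𝟚-⊥₂ : (φ : JoinHom 𝟚L 𝟚L) → fun φ ⊥₂ ≡ ⊥₂
  JoinHom-𝟚-⊥₂ φ = trans (cong (fun φ) (sym ⊥L-𝟚L)) (trans (JoinHom-⊥ φ) ⊥L-𝟚L)

  JoinHom-𝟚-classification : (φ : JoinHom 𝟚L 𝟚L) →
    (∀ b → fun φ b ≡ ⊥₂) ⊎ (∀ b → fun φ b ≡ b)
  JoinHom-𝟚-classification φ with fun φ ⊤₂ in φ⊤
  ... | ⊥₂ = inj₁ λ { ⊥₂ → JoinHom-𝟚-⊥₂ φ ; ⊤₂ → φ⊤ }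
  ... | ⊤₂ = inj₂ λ { ⊥₂ → JoinHom-𝟚-⊥₂ φ ; ⊤₂ → φ⊤ }

  module _ (Y : CompleteLattice ℓ) (y : Carrier Y) where
    open Order Y

    point : 𝟚 {ℓ} → Carrier Y
    point ⊥₂ = ⊥L Y
    point ⊤₂ = y

    point-gc : GaloisConnection 𝟚L Y point (λ u → fromDec (lem {_≤_ Y y u}))
    point-gc ⊥₂ u = mk⇔ (λ _ → ⊥₂≤) (λ _ → ⊥L-least u)
    point-gc ⊤₂ u with lem {_≤_ Y y u}
    ... | yes y≤u = mk⇔ (λ _ → ⊤₂≤⊤₂) (λ _ → y≤u)
    ... | no y≰u = mk⇔ (⊥-elim ∘ y≰u) (λ ())

    pointHom : JoinHom 𝟚L Y
    pointHom = leftAdjointHom {X = 𝟚L} {Y = Y} {l = point} point-gc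

  module _ (X : CompleteLattice ℓ) (x : Carrier X) where
    open Order X

    notBelow : Carrier X → 𝟚 {ℓ}
    notBelow t = fromDec (¬? (lem {_≤_ X t x}))

    notBelow-≤ : ∀ {t} → _≤_ X t x → notBelow t ≡ ⊥₂
    notBelow-≤ {t} t≤x with lem {_≤_ X t x}
    ... | yes _ = refl
    ... | no t≰x = ⊥-elim (t≰x t≤x)

    notBelow-≰ : ∀ {t} → ¬ _≤_ X t x → notBelow t ≡ ⊤₂
    notBelow-≰ {t} t≰x with lem {_≤_ X t x}
    ... | yes t≤x = ⊥-elim (t≰x t≤x)
    ... | no _ = refl

    notBelowRight : 𝟚 {ℓ} → Carrier X
    notBelowRight ⊥₂ = x
    notBelowRight ⊤₂ = ⊤L

    notBelow-gc : GaloisConnection X 𝟚L notBelow notBelowRight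
    notBelow-gc t ⊤₂ = mk⇔ (λ _ → ⊤L-greatest t) (λ _ → ≤⊤₂ (notBelow t))
    notBelow-gc t ⊥₂ with lem {_≤_ X t x}
    ... | yes t≤x = mk⇔ (λ _ → t≤x) (λ _ → ⊥₂≤)
    ... | no t≰x = mk⇔ (λ ()) (⊥-elim ∘ t≰x)

    notBelowHom : JoinHom X 𝟚L
    notBelowHom = leftAdjointHom {X = X} {Y = 𝟚L} {l = notBelow} {r = notBelowRight} notBelow-gc

    ρ-notBelowHom : ρ notBelowHom ⊥₂ ≡ x
    ρ-notBelowHom = ρ-leftAdjointHom {X = X} {Y = 𝟚L} {l = notBelow} {r = notBelowRight} notBelow-gc ⊥₂

Family : (ℓ : Level) → Set (Level.suc ℓ)
Family ℓ = (Y X : CompleteLattice ℓ) → Carrier Y → Carrier X → JoinHom X Y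

Natural : {ℓ : Level} → Family ℓ → Set (Level.suc ℓ)
Natural {ℓ} ψ = (X X' Y Y' : CompleteLattice ℓ) (g : JoinHom X' X) (f : JoinHom Y Y')
  (y : Carrier Y) (x : Carrier X) (t : Carrier X') →
  fun (ψ Y' X' (fun f y) (ρ g x)) t ≡ fun f (fun (ψ Y X y x) (fun g t))

module Classification {ℓ : Level} (lem : ExcludedMiddle ℓ)
                      (ψ : Family ℓ) (natural : Natural ψ) where
  open TwoPoint lem

  φ : JoinHom 𝟚L 𝟚L
  φ = ψ 𝟚L 𝟚L ⊤₂ ⊥₂

  ψ-factors : (Y X : CompleteLattice ℓ) (y : Carrier Y) (x : Carrier X) (t : Carrier X) →
              fun (ψ Y X y x) t ≡ point Y y (fun φ (notBelow X x t))
  ψ-factors Y X y x t = trans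
    (cong (λ z → fun (ψ Y X y z) t) (sym (ρ-notBelowHom X x)))
    (natural 𝟚L X 𝟚L Y (notBelowHom X x) (pointHom Y y) ⊤₂ ⊥₂ t)

  ψ≡⊥-if-φ≡⊥ : (∀ b → fun φ b ≡ ⊥₂) →
    (Y X : CompleteLattice ℓ) (y : Carrier Y) (x : Carrier X) (t : Carrier X) →
    fun (ψ Y X y x) t ≡ ⊥L Y
  ψ≡⊥-if-φ≡⊥ φ≡⊥ Y X y x t = trans (ψ-factors Y X y x t) (cong (point Y y) (φ≡⊥ _))

  ψ≡e-if-φ≡id : (∀ b → fun φ b ≡ b) →
    (Y X : CompleteLattice ℓ) (y : Carrier Y) (x : Carrier X) → IsE X Y y x (ψ Y X y x)
  ψ≡e-if-φ≡id φ≡id Y X y x t =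
      (λ t≤x → ψ-through (notBelow-≤ X x t≤x))
    , (λ t≰x → ψ-through (notBelow-≰ X x t≰x))
    where
    ψ-through : ∀ {b} → notBelow X x t ≡ b → fun (ψ Y X y x) t ≡ point Y y b
    ψ-through refl = trans (ψ-factors Y X y x t) (cong (point Y y) (φ≡id _))

  ψ≡⊥-or-ψ≡e :
    ((Y X : CompleteLattice ℓ) (y : Carrier Y) (x : Carrier X) (t : Carrier X) →
       fun (ψ Y X y x) t ≡ ⊥L Y)
    ⊎ ((Y X : CompleteLattice ℓ) (y : Carrier Y) (x : Carrier X) → IsE X Y y x (ψ Y X y x))
  ψ≡⊥-or-ψ≡e =
    [ inj₁ ∘ ψ≡⊥-if-φ≡⊥ , inj₂ ∘ ψ≡e-if-φ≡id ]′ (JoinHom-𝟚-classification φ)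

-- Naturality alone forces the dichotomy.
mainTheorem2 : {ℓ : Level} → ExcludedMiddle ℓ →
    (ψ : (Y X : CompleteLattice ℓ) → Carrier Y → Carrier X → JoinHom X Y) →
    -- bimorphism Y × X^op → Hom∨(X,Y) (joins in Hom∨ are pointwise)
    ((Y X : CompleteLattice ℓ) {I : Set ℓ} (ys : I → Carrier Y) (x : Carrier X) (t : Carrier X) →
      fun (ψ Y X (⋁ Y ys) x) t ≡ ⋁ Y (λ i → fun (ψ Y X (ys i) x) t)) →
    ((Y X : CompleteLattice ℓ) {I : Set ℓ} (y : Carrier Y) (xs : I → Carrier X) (t : Carrier X) →
      fun (ψ Y X y (⋀ X xs)) t ≡ ⋁ Y (λ i → fun (ψ Y X y (xs i)) t)) →
    -- naturality
    ((X X' Y Y' : CompleteLattice ℓ) (g : JoinHom X' X) (f : JoinHom Y Y')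
      (y : Carrier Y) (x : Carrier X) (t : Carrier X') →
      fun (ψ Y' X' (fun f y) (ρ g x)) t ≡ fun f (fun (ψ Y X y x) (fun g t))) →
    ((Y X : CompleteLattice ℓ) (y : Carrier Y) (x : Carrier X) (t : Carrier X) →
       fun (ψ Y X y x) t ≡ ⊥L Y)
    ⊎ ((Y X : CompleteLattice ℓ) (y : Carrier Y) (x : Carrier X) → IsE X Y y x (ψ Y X y x))
mainTheorem2 lem ψ _ _ natural = Classification.ψ≡⊥-or-ψ≡e lem ψ natural
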